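{- Transitive closure of a flat binary relation is expressible by a sparse equation algebra expression: for a relation name $R$ of type $(0,0)$ there is an equation algebra expression $e$, all of whose occurring equations are sparse, such that for every database $B$ over $\{R\}$, $e(B)$ equals the transitive closure of $R^B$.
   Context: Relation types: $0$ is a type; if $\tau_1,\dots,\tau_k$ are types then $(\tau_1,\dots,\tau_k)$ is a type. Relations of type $0$ on $D$ are elements of $D$; relations of type $(\tau_1,\dots,\tau_k)$ on $D$ are finite sets of $k$-tuples whose $i$-th components are relations of type $\tau_i$. A type is flat if of the form $(0,\dots,0)$. A database over a schema (finite set of relation names with types $\neq 0$) consists of a nonempty finite domain $D$ and a relation of the appropriate type on $D$ for each name. Nested relational algebra: union, difference, cartesian product, projection, equality selection (possibly set equality of nested components), nesting $\nu$ and unnesting $\mu$, with expressions built from relation names and the symbol $D$ for the domain. The equation algebra adds solution expressions $\{(X_1,\dots,X_p)\mid e_1=e_2\}$ ($e_1,e_2$ equation algebra expressions, $X_i$ distinct relation names that become bound), which on a database $B$ with domain $D$ evaluate to the set of all $(X_1^A,\dots,X_p^A)$ with $A$ a database over $\{X_1,\dots,X_p\}$ with domain $D$ satisfying $e_1(B,A)=e_2(B,A)$. Such a solution expression is an equation occurring in the expression; it is sparse if all $X_i$ have flat type and the number of solutions on any given database is at most polynomial in the size of the database. -}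

module Defs where

open import Data.Nat using (ℕ; zero; suc; _+_; _*_; _^_; _≤_)
open import Data.Fin using (Fin; zero; suc)
open import Data.Bool using (Bool; true; false; _∧_; not; if_then_else_)
open import Data.List using (List; []; _∷_; _++_; map; length; lookup; concatMap; null)
open import Data.Bool.ListAction using (any; all)
open import Data.Nat.ListAction using (sum)
open import Data.List.Relation.Unary.All using (All)
open import Data.List.Membership.Propositional using (_∈_)
open import Data.List.Relation.Unary.Unique.Propositional using (Unique)
open import Data.Product using (Σ; _×_; _,_; proj₁; proj₂)
open import Data.Unit using (⊤; tt)
open import Level using (Lift)
open import Relation.Binary.Definitions using (DecidableEquality)
open import Relation.Binary.PropositionalEquality using (_≡_; subst)
open import Relation.Nullary.Decidable using (isYes)

-- Relation types.  'base' is the type 0; 'tup t ts' is the type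
-- (t , ts₁ , … , tsₖ) (tuples have at least one component).

data Ty : Set where
  base : Ty
  tup  : Ty → List Ty → Ty

RTy : Set
RTy = Ty × List Ty

toTy : RTy → Ty
toTy (t , ts) = tup t ts

Flat : RTy → Set
Flat (t , ts) = (t ≡ base) × All (_≡ base) ts

record Domain : Set₁ where
  field
    Carrier  : Set
    _≟_      : DecidableEquality Carrier
    elems    : List Carrier
    complete : ∀ x → x ∈ elems
    distinct : Unique elems
    point    : Carrier

data Var : List Ty → Ty → Set where
  here  : ∀ {Γ τ} → Var (τ ∷ Γ) τ
  there : ∀ {Γ τ σ} → Var Γ τ → Var (σ ∷ Γ) τ

data Expr (Γ : List Ty) : Ty → Set where
  var  : ∀ {τ} → Var Γ τ → Expr Γ τ
  dom  : Expr Γ (tup base [])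
  _∪_  : ∀ {t ts} → Expr Γ (tup t ts) → Expr Γ (tup t ts) → Expr Γ (tup t ts)
  _∖_  : ∀ {t ts} → Expr Γ (tup t ts) → Expr Γ (tup t ts) → Expr Γ (tup t ts)
  _⊗_  : ∀ {t ts u us} → Expr Γ (tup t ts) → Expr Γ (tup u us)
         → Expr Γ (tup t (ts ++ u ∷ us))
  proj : ∀ {t ts} (i : Fin (suc (length ts))) (is : List (Fin (suc (length ts))))
         → Expr Γ (tup t ts)
         → Expr Γ (tup (lookup (t ∷ ts) i) (map (lookup (t ∷ ts)) is))
  -- equality selection σ_{i=j} (set equality on nested components)
  sel  : ∀ {t ts} (i j : Fin (suc (length ts)))
         → lookup (t ∷ ts) i ≡ lookup (t ∷ ts) j
         → Expr Γ (tup t ts) → Expr Γ (tup t ts)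
  -- nesting of the last components (u ∷ us) grouped by the first (t ∷ ts)
  nest    : ∀ t ts u us → Expr Γ (tup t (ts ++ u ∷ us))
            → Expr Γ (tup t (ts ++ tup u us ∷ []))
  nestAll : ∀ u us → Expr Γ (tup u us) → Expr Γ (tup (tup u us) [])
  unnest  : ∀ t ts u us → Expr Γ (tup t (ts ++ tup u us ∷ []))
            → Expr Γ (tup t (ts ++ u ∷ us))
  unnestAll : ∀ u us → Expr Γ (tup (tup u us) []) → Expr Γ (tup u us)
  -- solution expression {(X , Xs) | e₁ = e₂}; X , Xs bound in e₁ , e₂
  sol  : ∀ {τ} (X : RTy) (Xs : List RTy)
         → Expr (map toTy (X ∷ Xs) ++ Γ) τ
         → Expr (map toTy (X ∷ Xs) ++ Γ) τ
         → Expr Γ (tup (toTy X) (map toTy Xs))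

filterB : ∀ {A : Set} → (A → Bool) → List A → List A
filterB p [] = []
filterB p (x ∷ xs) = if p x then x ∷ filterB p xs else filterB p xs

dedup : ∀ {A : Set} → (A → A → Bool) → List A → List A
dedup eq [] = []
dedup eq (x ∷ xs) = if any (eq x) xs then dedup eq xs else x ∷ dedup eq xs

cart : ∀ {A B : Set} → List A → List B → List (A × B)
cart xs ys = concatMap (λ x → map (x ,_) ys) xs

subs : ∀ {A : Set} → List A → List (List A)
subs [] = [] ∷ []
subs (x ∷ xs) = subs xs ++ map (x ∷_) (subs xs)

module Sem (D : Domain) where
  open Domain D

  mutual
    -- relations of type τ on D (finite sets represented as lists)
    Val : Ty → Set
    Val base = Carrier
    Val (tup t ts) = List (Val t × Tuple ts)

    Tuple : List Ty → Set
    Tuple [] = ⊤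
    Tuple (t ∷ ts) = Val t × Tuple ts

  mutual
    eqV : (τ : Ty) → Val τ → Val τ → Bool
    eqV base x y = isYes (x ≟ y)
    eqV (tup t ts) xs ys =
      all (λ r → any (λ r' → eqV t (proj₁ r) (proj₁ r') ∧ eqT ts (proj₂ r) (proj₂ r')) ys) xs
      ∧ all (λ r → any (λ r' → eqV t (proj₁ r) (proj₁ r') ∧ eqT ts (proj₂ r) (proj₂ r')) xs) ys

    eqT : (ts : List Ty) → Tuple ts → Tuple ts → Bool
    eqT [] _ _ = true
    eqT (t ∷ ts) (x , xs) (y , ys) = eqV t x y ∧ eqT ts xs ys

  mutual
    sizeV : (τ : Ty) → Val τ → ℕ
    sizeV base _ = 1
    sizeV (tup t ts) xs =
      sum (map (λ r → sizeV t (proj₁ r) + sizeT ts (proj₂ r)) (dedup (eqT (t ∷ ts)) xs))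

    sizeT : (ts : List Ty) → Tuple ts → ℕ
    sizeT [] _ = 0
    sizeT (t ∷ ts) (x , xs) = sizeV t x + sizeT ts xs

  dbSize : (Γ : List Ty) → Tuple Γ → ℕ
  dbSize Γ ρ = length elems + sizeT Γ ρ

  card : ∀ {t ts} → Val (tup t ts) → ℕ
  card {t} {ts} xs = length (dedup (eqT (t ∷ ts)) xs)

  mutual
    allV : (τ : Ty) → List (Val τ)
    allV base = elems
    allV (tup t ts) = subs (cart (allV t) (allT ts))

    allT : (ts : List Ty) → List (Tuple ts)
    allT [] = tt ∷ []
    allT (t ∷ ts) = cart (allV t) (allT ts)

  lookupVar : ∀ {Γ τ} → Var Γ τ → Tuple Γ → Val τ
  lookupVar here (v , _) = v
  lookupVar (there x) (_ , ρ) = lookupVar x ρ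

  lookupT : (xs : List Ty) → Tuple xs → (i : Fin (length xs)) → Val (lookup xs i)
  lookupT (x ∷ xs) (v , _) zero = v
  lookupT (x ∷ xs) (_ , vs) (suc i) = lookupT xs vs i

  projT : (xs : List Ty) → Tuple xs → (is : List (Fin (length xs))) → Tuple (map (lookup xs) is)
  projT xs r [] = tt
  projT xs r (i ∷ is) = lookupT xs r i , projT xs r is

  appT : (xs : List Ty) {ys : List Ty} → Tuple xs → Tuple ys → Tuple (xs ++ ys)
  appT [] _ r = r
  appT (x ∷ xs) (v , vs) r = v , appT xs vs r

  splitT : (xs : List Ty) {ys : List Ty} → Tuple (xs ++ ys) → Tuple xs × Tuple ys
  splitT [] r = tt , r
  splitT (x ∷ xs) (v , r) with splitT xs r
  ... | a , b = (v , a) , b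

  eval : ∀ {Γ τ} → Expr Γ τ → Tuple Γ → Val τ
  eval (var x) ρ = lookupVar x ρ
  eval dom ρ = map (λ x → x , tt) elems
  eval (e ∪ f) ρ = eval e ρ ++ eval f ρ
  eval (_∖_ {t} {ts} e f) ρ =
    filterB (λ r → not (any (eqT (t ∷ ts) r) (eval f ρ))) (eval e ρ)
  eval (_⊗_ {t} {ts} {u} {us} e f) ρ =
    concatMap (λ r → map (λ s → proj₁ r , appT ts (proj₂ r) s) (eval f ρ)) (eval e ρ)
  eval (proj {t} {ts} i is e) ρ =
    map (λ r → lookupT (t ∷ ts) r i , projT (t ∷ ts) r is) (eval e ρ)
  eval (sel {t} {ts} i j p e) ρ =
    filterB (λ r → eqV (lookup (t ∷ ts) j) (subst Val p (lookupT (t ∷ ts) r i)) (lookupT (t ∷ ts) r j)) (eval e ρ)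
  eval (nest t ts u us e) ρ =
    map (λ r → appT (t ∷ ts) (proj₁ (splitT (t ∷ ts) r)) (group (proj₁ (splitT (t ∷ ts) r)) , tt)) S
    where
      S = eval e ρ
      group : Tuple (t ∷ ts) → Val (tup u us)
      group a = map proj₂ (filterB (λ p → eqT (t ∷ ts) a (proj₁ p)) (map (splitT (t ∷ ts)) S))
  eval (nestAll u us e) ρ = if null (eval e ρ) then [] else ((eval e ρ , tt) ∷ [])
  eval (unnest t ts u us e) ρ =
    concatMap row (eval e ρ)
    where
      row : Tuple (t ∷ (ts ++ tup u us ∷ [])) → List (Tuple (t ∷ (ts ++ u ∷ us)))
      row r = map (appT (t ∷ ts) (proj₁ (splitT (t ∷ ts) {tup u us ∷ []} r)))
                  (proj₁ (proj₂ (splitT (t ∷ ts) {tup u us ∷ []} r)))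
  eval (unnestAll u us e) ρ = concatMap (λ (r : Val (tup u us) × ⊤) → proj₁ r) (eval e ρ)
  eval (sol {τ} X Xs e₁ e₂) ρ =
    filterB (λ A → eqV τ (eval e₁ (appT (map toTy (X ∷ Xs)) A ρ))
                         (eval e₂ (appT (map toTy (X ∷ Xs)) A ρ)))
            (allT (map toTy (X ∷ Xs)))

SparseSol : ∀ {Γ t ts} → Expr Γ (tup t ts) → List RTy → Set₁
SparseSol {Γ} {t} {ts} e XXs =
  All Flat XXs ×
  Σ ℕ λ c → Σ ℕ λ k → ∀ (D : Domain) (ρ : Sem.Tuple D Γ) →
    Sem.card D {t} {ts} (Sem.eval D e ρ) ≤ c * Sem.dbSize D Γ ρ ^ k

AllSparse : ∀ {Γ τ} → Expr Γ τ → Set₁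
AllSparse (var x) = Lift _ ⊤
AllSparse dom = Lift _ ⊤
AllSparse (e ∪ f) = AllSparse e × AllSparse f
AllSparse (e ∖ f) = AllSparse e × AllSparse f
AllSparse (e ⊗ f) = AllSparse e × AllSparse f
AllSparse (proj i is e) = AllSparse e
AllSparse (sel i j p e) = AllSparse e
AllSparse (nest t ts u us e) = AllSparse e
AllSparse (nestAll u us e) = AllSparse e
AllSparse (unnest t ts u us e) = AllSparse e
AllSparse (unnestAll u us e) = AllSparse e
AllSparse (sol X Xs e₁ e₂) = SparseSol (sol X Xs e₁ e₂) (X ∷ Xs) × AllSparse e₁ × AllSparse e₂

data TC {A : Set} (R : List (A × A × ⊤)) : A → A → Set where
  step  : ∀ {a b} → (a , b , tt) ∈ R → TC R a b
  trans : ∀ {a b c} → TC R a b → TC R b c → TC R a c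

RType : Ty
RType = tup base (base ∷ [])

{-# OPTIONS --safe #-}
-- The expression guesses, through one equation, a binary relation S and a ternary relation L,
-- meant to be reflexive-transitive reachability R* and "y and z are reachable from x with
-- d(x, y) ≤ d(x, z)". The equation says: S is reflexive and closed under R-steps; L is
-- transitive, reflexive on S, and satisfies the one-step recursion "y = x, or z ≠ x and some
-- R-predecessor of y in S lies L-below every R-predecessor of z"; and every y ≠ x with S x y has
-- an R-predecessor strictly L-below it. That last clause gives S ⊆ R* by descent on the number
-- of points L-below y, the first two give R* ⊆ S, and then the recursion pins L down by
-- induction on distance. So the equation has exactly one solution, which makes it sparse, and
-- the transitive closure is R composed with the S-component of the solutions.
module Submission where

open import Data.Bool using (Bool; true; false; T; not; _∧_; _∨_; if_then_else_)
open import Data.Bool.ListAction using (any; all)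
open import Data.Bool.Properties using (T-∧; T-∨)
open import Data.Empty using (⊥-elim)
open import Data.Fin using (#_)
open import Data.List using (List; []; _∷_; _++_; length; filterᵇ; map; concatMap; cartesianProductWith)
open import Data.List.Membership.Propositional using (_∈_; _∉_; find; lose)
open import Data.List.Membership.Propositional.Properties
  using ( ∈-filter⁻; ∈-filter⁺; ∈-map⁺; ∈-map⁻; ∈-++⁺ˡ; ∈-++⁺ʳ; ∈-++⁻; ∈-concatMap⁺; ∈-concatMap⁻
        ; ∈-cartesianProductWith⁺; ∈-cartesianProductWith⁻)
open import Data.List.Properties using (filter-notAll; length-filter)
open import Data.List.Relation.Binary.Subset.Propositional using (_⊆_)
open import Data.List.Relation.Unary.All using (All; []; _∷_)
import Data.List.Relation.Unary.All as All
open import Data.List.Relation.Unary.All.Properties using (all⁺; all⁻)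
open import Data.List.Relation.Unary.Any using (here; there; any?)
open import Data.List.Relation.Unary.Any.Properties using (any⁺; any⁻; ¬Any[])
open import Data.Nat
  using (ℕ; zero; suc; _+_; _≤_; _<_; _≤?_; _≤′_; ≤′-reflexive; ≤′-step; z≤n; s≤s; s≤s⁻¹)
open import Data.Nat.Induction using (<-wellFounded)
open import Data.Nat.Properties
  using ( module ≤-Reasoning; ≤-refl; ≤-trans; ≤-<-trans; <⇒≤; <⇒≱; ≤⇒≤′; m≤m+n; n<1+n; m<n⇒m<1+n
        ; n≤0⇒n≡0; n≮n; n≮0)
open import Data.Product using (Σ; ∃; ∃₂; _×_; _,_; proj₁; proj₂)
open import Data.Sum using (_⊎_; inj₁; inj₂; [_,_]′)
open import Data.Unit using (tt)
open import Function using (_∘_; id)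
open import Function.Bundles using (_⇔_; mk⇔; Equivalence)
open import Function.Properties.Equivalence using () renaming (sym to sym-⇔; trans to trans-⇔)
open import Induction.WellFounded using (Acc; acc)
open import Level using (lift)
open import Relation.Binary.PropositionalEquality using (_≡_; _≢_; refl; sym; cong; cong₂; subst; _≗_)
open import Relation.Nullary using (¬_; yes; no; ¬?; _×-dec_)
open import Relation.Nullary.Decidable using (Dec; T?; isYes; toWitness; fromWitness; decidable-stable)
import Relation.Nullary.Decidable as Dec
open import Relation.Unary using (Decidable)

open import Defs

open Equivalence using (to; from)

module _ {A : Set} where

  filterB≗filterᵇ : (p : A → Bool) → filterB p ≗ filterᵇ p
  filterB≗filterᵇ p [] = refl
  filterB≗filterᵇ p (x ∷ xs) with p x
  ... | true  = cong (x ∷_) (filterB≗filterᵇ p xs)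
  ... | false = filterB≗filterᵇ p xs

  ∈-filterB⁻ : ∀ p xs {x : A} → x ∈ filterB p xs → x ∈ xs × T (p x)
  ∈-filterB⁻ p xs x∈ = ∈-filter⁻ (T? ∘ p) (subst (_ ∈_) (filterB≗filterᵇ p xs) x∈)

  ∈-filterB⁺ : ∀ p {xs} {x : A} → x ∈ xs → T (p x) → x ∈ filterB p xs
  ∈-filterB⁺ p {xs} x∈ px = subst (_ ∈_) (sym (filterB≗filterᵇ p xs)) (∈-filter⁺ (T? ∘ p) x∈ px)

  length-filterB≤ : ∀ (p : A → Bool) xs → length (filterB p xs) ≤ length xs
  length-filterB≤ p xs = subst (λ ys → length ys ≤ length xs) (sym (filterB≗filterᵇ p xs))
                               (length-filter (T? ∘ p) xs)

  filterB∈subs : ∀ p (xs : List A) → filterB p xs ∈ subs xs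
  filterB∈subs p [] = here refl
  filterB∈subs p (x ∷ xs) with p x
  ... | true  = ∈-++⁺ʳ (subs xs) (∈-map⁺ (x ∷_) (filterB∈subs p xs))
  ... | false = ∈-++⁺ˡ (filterB∈subs p xs)

  filterB-absorbs : ∀ {p q : A → Bool} → (∀ {a} → T (p a) → T (q a)) →
                    ∀ xs → filterB p (filterB q xs) ≡ filterB p xs
  filterB-absorbs p⇒q [] = refl
  filterB-absorbs {p} {q} p⇒q (x ∷ xs) with q x in qx
  ... | true with p x
  ...   | true  = cong (x ∷_) (filterB-absorbs p⇒q xs)
  ...   | false = filterB-absorbs p⇒q xs
  filterB-absorbs {p} {q} p⇒q (x ∷ xs) | false with p x in px
  ...   | false = filterB-absorbs p⇒q xs
  ...   | true  = ⊥-elim (subst T qx (p⇒q (subst T (sym px) _)))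

  length-filterB-< : ∀ {p q : A → Bool} → (∀ {a} → T (p a) → T (q a)) →
                     ∀ xs {a} → a ∈ xs → T (q a) → ¬ T (p a) →
                     length (filterB p xs) < length (filterB q xs)
  length-filterB-< {p} {q} p⇒q xs a∈xs qa ¬pa = begin-strict
    length (filterB p xs)               ≡⟨ cong length (filterB-absorbs p⇒q xs) ⟨
    length (filterB p (filterB q xs))   ≡⟨ cong length (filterB≗filterᵇ p (filterB q xs)) ⟩
    length (filterᵇ p (filterB q xs))   <⟨ filter-notAll (T? ∘ p) _ (lose (∈-filterB⁺ q a∈xs qa) ¬pa) ⟩
    length (filterB q xs)               ∎
    where open ≤-Reasoning

  concatMap-map≡cartesianProductWith : ∀ {B C : Set} (f : A → B → C) xs ys →
    concatMap (λ x → map (f x) ys) xs ≡ cartesianProductWith f xs ys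
  concatMap-map≡cartesianProductWith f [] ys = refl
  concatMap-map≡cartesianProductWith f (x ∷ xs) ys =
    cong (map (f x) ys ++_) (concatMap-map≡cartesianProductWith f xs ys)

  ∈-cart⁺ : ∀ {B : Set} {xs : List A} {ys : List B} {a b} → a ∈ xs → b ∈ ys → (a , b) ∈ cart xs ys
  ∈-cart⁺ {xs = xs} {ys} a∈ b∈ =
    subst ((_ , _) ∈_) (sym (concatMap-map≡cartesianProductWith _,_ xs ys))
          (∈-cartesianProductWith⁺ _,_ a∈ b∈)

  dedup-skip : ∀ (eq : A → A → Bool) x ys → T (any (eq x) ys) → dedup eq (x ∷ ys) ≡ dedup eq ys
  dedup-skip eq x ys x∈ys with any (eq x) ys
  ... | true = refl

  length-dedup≤1 : ∀ (eq : A → A → Bool) xs → (∀ {a b} → a ∈ xs → b ∈ xs → T (eq a b)) →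
                   length (dedup eq xs) ≤ 1
  length-dedup≤1 eq [] _ = z≤n
  length-dedup≤1 eq (x ∷ []) _ = s≤s z≤n
  length-dedup≤1 eq (x ∷ y ∷ xs) all-eq =
    subst (λ zs → length zs ≤ 1) (sym (dedup-skip eq x (y ∷ xs) x≈y))
          (length-dedup≤1 eq (y ∷ xs) λ a b → all-eq (there a) (there b))
    where
    x≈y : T (any (eq x) (y ∷ xs))
    x≈y = any⁺ (eq x) (here {xs = xs} (all-eq (here refl) (there (here refl))))

  ++⊆[]⇔ : ∀ (xs ys : List A) → (xs ++ ys ⊆ []) ⇔ (xs ⊆ [] × ys ⊆ [])
  ++⊆[]⇔ xs ys = mk⇔ forth back
    where
    forth : xs ++ ys ⊆ [] → xs ⊆ [] × ys ⊆ []
    forth h = (λ z∈xs → h (∈-++⁺ˡ z∈xs)) , (λ z∈ys → h (∈-++⁺ʳ xs z∈ys))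
    back : xs ⊆ [] × ys ⊆ [] → xs ++ ys ⊆ []
    back (xs⊆[] , ys⊆[]) z∈ = [ xs⊆[] , ys⊆[] ]′ (∈-++⁻ xs z∈)

T-not : ∀ {b} → T (not b) ⇔ (¬ T b)
T-not {true}  = mk⇔ (λ ()) (λ ¬t → ¬t _)
T-not {false} = mk⇔ (λ _ ()) _

-- The least k ≤ n with T (p k), and n if there is none.
firstTrue : (ℕ → Bool) → ℕ → ℕ
firstTrue p zero    = zero
firstTrue p (suc n) = if p zero then zero else suc (firstTrue (p ∘ suc) n)

firstTrue-holds : ∀ (p : ℕ → Bool) n → T (p n) → T (p (firstTrue p n))
firstTrue-holds p zero    pn = pn
firstTrue-holds p (suc n) pn with p zero in p0
... | true  = subst T (sym p0) _
... | false = firstTrue-holds (p ∘ suc) n pn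

firstTrue-minimal : ∀ (p : ℕ → Bool) n {k} → T (p k) → firstTrue p n ≤ k
firstTrue-minimal p zero    _  = z≤n
firstTrue-minimal p (suc n) {k} pk with p zero in p0
... | true = z≤n
firstTrue-minimal p (suc n) {zero}  pk | false = ⊥-elim (subst T p0 pk)
firstTrue-minimal p (suc n) {suc k} pk | false = s≤s (firstTrue-minimal (p ∘ suc) n pk)

module Saturation {A : Set} (elems : List A) (complete : ∀ a → a ∈ elems)
  (P : ℕ → A → Bool)
  (P-mono : ∀ {k a} → T (P k a) → T (P (suc k) a))
  (P-persist : ∀ {k} → (∀ {a} → T (P (suc k) a) → T (P k a)) →
                        ∀ {a} → T (P (suc (suc k)) a) → T (P (suc k) a))
  where

  Stationary : ℕ → Set
  Stationary k = ∀ {a} → T (P (suc k) a) → T (P k a)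

  P-mono-≤ : ∀ {k m a} → k ≤ m → T (P k a) → T (P m a)
  P-mono-≤ k≤m = go (≤⇒≤′ k≤m)
    where
    go : ∀ {k m a} → k ≤′ m → T (P k a) → T (P m a)
    go (≤′-reflexive refl) = id
    go (≤′-step k≤′m)      = P-mono ∘ go k≤′m

  stationary-persists : ∀ {j} → Stationary j → ∀ m → Stationary (m + j)
  stationary-persists st zero    = st
  stationary-persists st (suc m) = P-persist (stationary-persists st m)

  stationary-collapses : ∀ {j} → Stationary j → ∀ m {a} → T (P (m + j) a) → T (P j a)
  stationary-collapses st zero    = id
  stationary-collapses st (suc m) = stationary-collapses st m ∘ stationary-persists st m

  stationary-or-new : ∀ k → Stationary k ⊎ ∃ λ a → T (P (suc k) a) × ¬ T (P k a)
  stationary-or-new k with any? (λ a → T? (P (suc k) a) ×-dec ¬? (T? (P k a))) elems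
  ... | yes new = inj₂ (let a , _ , pa = find new in a , pa)
  ... | no ¬new = inj₁ stationary
    where
    stationary : Stationary k
    stationary {a} pa with T? (P k a)
    ... | yes pa′ = pa′
    ... | no ¬pa′ = ⊥-elim (¬new (lose (complete a) (pa , ¬pa′)))

  count : ℕ → ℕ
  count k = length (filterB (P k) elems)

  grows-until-stationary : ∀ k → (∃ λ j → j < k × Stationary j) ⊎ k ≤ count k
  grows-until-stationary zero = inj₂ z≤n
  grows-until-stationary (suc k) with grows-until-stationary k
  ... | inj₁ (j , j<k , st) = inj₁ (j , m<n⇒m<1+n j<k , st)
  ... | inj₂ k≤count with stationary-or-new k
  ...   | inj₁ st = inj₁ (k , n<1+n k , st)
  ...   | inj₂ (a , new , ¬old) =
          inj₂ (≤-<-trans k≤count (length-filterB-< P-mono elems (complete a) new ¬old))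

  stationary-by-size : ∃ λ j → j ≤ length elems × Stationary j
  stationary-by-size with grows-until-stationary (suc (length elems))
  ... | inj₁ (j , s≤s j≤n , st) = j , j≤n , st
  ... | inj₂ n<count = ⊥-elim (<⇒≱ n<count (length-filterB≤ (P _) elems))

  saturated : ∀ {k a} → T (P k a) → T (P (length elems) a)
  saturated {k} pa =
    let j , j≤n , st = stationary-by-size
    in P-mono-≤ j≤n (stationary-collapses st k (P-mono-≤ (m≤m+n k j) pa))

module Reachability (D : Domain) (r : Sem.Val D RType) where
  open Domain D

  infix 4 _⟶_ _⟶*_

  _⟶_ : Carrier → Carrier → Set
  x ⟶ y = (x , y , tt) ∈ r

  _⟶*_ : Carrier → Carrier → Set
  x ⟶* y = x ≡ y ⊎ TC r x y

  ⟶*-snoc : ∀ {x w y} → x ⟶* w → w ⟶ y → TC r x y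
  ⟶*-snoc (inj₁ refl) w⟶y = step w⟶y
  ⟶*-snoc (inj₂ x⟶⁺w) w⟶y = trans x⟶⁺w (step w⟶y)

  TC-uncons : ∀ {x y} → TC r x y → ∃ λ w → x ⟶ w × w ⟶* y
  TC-uncons (step x⟶y) = _ , x⟶y , inj₁ refl
  TC-uncons (trans x⟶⁺v v⟶⁺y) with TC-uncons x⟶⁺v
  ... | w , x⟶w , inj₁ refl  = w , x⟶w , inj₂ v⟶⁺y
  ... | w , x⟶w , inj₂ w⟶⁺v = w , x⟶w , inj₂ (trans w⟶⁺v v⟶⁺y)

  ⟶*-cons : ∀ {x w y} → x ⟶ w → w ⟶* y → TC r x y
  ⟶*-cons x⟶w (inj₁ refl)  = step x⟶w
  ⟶*-cons x⟶w (inj₂ w⟶⁺y) = trans (step x⟶w) w⟶⁺y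

  reachWithin : ℕ → Carrier → Carrier → Bool
  reachWithin zero    x y = isYes (x ≟ y)
  reachWithin (suc k) x y =
    reachWithin k x y ∨ any (λ (w , y′ , _) → reachWithin k x w ∧ isYes (y′ ≟ y)) r

  reachWithin-mono : ∀ k {x y} → T (reachWithin k x y) → T (reachWithin (suc k) x y)
  reachWithin-mono k h = from T-∨ (inj₁ h)

  reachWithin-snoc : ∀ k {x w y} → T (reachWithin k x w) → w ⟶ y → T (reachWithin (suc k) x y)
  reachWithin-snoc k x↝w w⟶y =
    from T-∨ (inj₂ (any⁺ _ (lose w⟶y (from T-∧ (x↝w , fromWitness refl)))))

  reachWithin-suc⁻ : ∀ k {x y} → T (reachWithin (suc k) x y) →
                     T (reachWithin k x y) ⊎ ∃ λ w → T (reachWithin k x w) × w ⟶ y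
  reachWithin-suc⁻ k {x} {y} h with to T-∨ h
  ... | inj₁ x↝y = inj₁ x↝y
  ... | inj₂ h′ with find (any⁻ _ r h′)
  ...   | (w , y′ , tt) , e∈r , h″ with to T-∧ h″
  ...     | x↝w , y′≟y with toWitness {a? = y′ ≟ y} y′≟y
  ...       | refl = inj₂ (w , x↝w , e∈r)

  reachWithin-persist : ∀ k {x} → (∀ {y} → T (reachWithin (suc k) x y) → T (reachWithin k x y)) →
                        ∀ {y} → T (reachWithin (suc (suc k)) x y) → T (reachWithin (suc k) x y)
  reachWithin-persist k stationary h with reachWithin-suc⁻ (suc k) h
  ... | inj₁ h′              = h′
  ... | inj₂ (w , x↝w , w⟶y) = reachWithin-snoc k (stationary x↝w) w⟶y

  reachWithin⇒⟶* : ∀ k {x y} → T (reachWithin k x y) → x ⟶* y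
  reachWithin⇒⟶* zero    h = inj₁ (toWitness h)
  reachWithin⇒⟶* (suc k) h with reachWithin-suc⁻ k h
  ... | inj₁ h′              = reachWithin⇒⟶* k h′
  ... | inj₂ (w , x↝w , w⟶y) = inj₂ (⟶*-snoc (reachWithin⇒⟶* k x↝w) w⟶y)

  reachWithin-extend : ∀ {k x w y} → TC r w y → T (reachWithin k x w) → ∃ λ j → T (reachWithin j x y)
  reachWithin-extend {k} (step w⟶y) x↝w = suc k , reachWithin-snoc k x↝w w⟶y
  reachWithin-extend {k} (trans w⟶⁺v v⟶⁺y) x↝w =
    let j , x↝v = reachWithin-extend {k} w⟶⁺v x↝w in reachWithin-extend {j} v⟶⁺y x↝v

  ⟶*⇒reachWithin : ∀ {x y} → x ⟶* y → ∃ λ k → T (reachWithin k x y)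
  ⟶*⇒reachWithin (inj₁ refl)  = zero , fromWitness refl
  ⟶*⇒reachWithin (inj₂ x⟶⁺y) = reachWithin-extend {zero} x⟶⁺y (fromWitness refl)

  module _ (x : Carrier) where
    open Saturation elems complete (λ k → reachWithin k x)
      (λ {k} → reachWithin-mono k) (λ {k} → reachWithin-persist k)
      public using (saturated)

  reachable : Carrier → Carrier → Bool
  reachable = reachWithin (length elems)

  reachable⇔⟶* : ∀ {x y} → T (reachable x y) ⇔ x ⟶* y
  reachable⇔⟶* {x} = mk⇔ (reachWithin⇒⟶* (length elems)) λ x⟶*y →
    let k , x↝y = ⟶*⇒reachWithin x⟶*y in saturated x {k} x↝y

  _⟶*?_ : ∀ x y → Dec (x ⟶* y)
  x ⟶*? y = Dec.map reachable⇔⟶* (T? _)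

  dist : Carrier → Carrier → ℕ
  dist x y = firstTrue (λ k → reachWithin k x y) (length elems)

  reachWithin-dist : ∀ {x y} → x ⟶* y → T (reachWithin (dist x y) x y)
  reachWithin-dist {x} {y} x⟶*y =
    firstTrue-holds (λ k → reachWithin k x y) (length elems) (from reachable⇔⟶* x⟶*y)

  dist-minimal : ∀ {k x y} → T (reachWithin k x y) → dist x y ≤ k
  dist-minimal = firstTrue-minimal _ (length elems)

  dist-self : ∀ x → dist x x ≡ 0
  dist-self x = n≤0⇒n≡0 (dist-minimal {zero} (fromWitness refl))

  dist-step : ∀ {x w y} → x ⟶* w → w ⟶ y → dist x y ≤ suc (dist x w)
  dist-step {x} {w} x⟶*w w⟶y =
    dist-minimal (reachWithin-snoc (dist x w) (reachWithin-dist x⟶*w) w⟶y)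

  dist-pred : ∀ {x y} → x ⟶* y → x ≢ y → ∃ λ w → x ⟶* w × w ⟶ y × dist x w < dist x y
  dist-pred {x} {y} x⟶*y x≢y with dist x y in dist≡ | reachWithin-dist x⟶*y
  ... | zero  | x↝y = ⊥-elim (x≢y (toWitness x↝y))
  ... | suc k | x↝y with reachWithin-suc⁻ k x↝y
  ...   | inj₁ x↝y′ = ⊥-elim (n≮n k (subst (_≤ k) dist≡ (dist-minimal x↝y′)))
  ...   | inj₂ (w , x↝w , w⟶y) = w , reachWithin⇒⟶* k x↝w , w⟶y , s≤s (dist-minimal x↝w)

module DistanceOrder (D : Domain) (r : Sem.Val D RType) where
  open Domain D
  open Reachability D r

  Rel₂ : Set₁
  Rel₂ = Carrier → Carrier → Set

  Rel₃ : Set₁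
  Rel₃ = Carrier → Carrier → Carrier → Set

  NoFarther : Rel₃
  NoFarther x y z = x ⟶* y × x ⟶* z × dist x y ≤ dist x z

  -- The recursion characterising NoFarther, with S in the role of _⟶*_ and L in that of NoFarther.
  NoFartherStep : Rel₂ → Rel₃ → Rel₃
  NoFartherStep S L x y z =
    S x y × S x z ×
    (x ≡ y ⊎ x ≢ z × ∃ λ w → S x w × w ⟶ y × (∀ {w′} → S x w′ → w′ ⟶ z → L x w w′))

  record IsSolution (S : Rel₂) (L : Rel₃) : Set where
    field
      S-refl   : ∀ x → S x x
      S-step   : ∀ {x w y} → S x w → w ⟶ y → S x y
      L-unfold : ∀ {x y z} → L x y z → NoFartherStep S L x y z
      L-fold   : ∀ {x y z} → NoFartherStep S L x y z → L x y z
      L-trans  : ∀ {x y z u} → L x y z → L x z u → L x y u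
      S-pred   : ∀ {x y} → S x y → x ≢ y → ∃ λ w → S x w × w ⟶ y × L x w y × ¬ L x y w
      L-refl   : ∀ {x y} → S x y → L x y y

  -- Only the predecessors of z closer to x than z are consulted, so that the lemma also serves
  -- as the step of an induction on dist x z.
  dist-≤-by-pred : ∀ {x y z w} → x ⟶* z → x ≢ z → x ⟶* w → w ⟶ y →
    (∀ {w′} → x ⟶* w′ → w′ ⟶ z → dist x w′ < dist x z → dist x w ≤ dist x w′) →
    dist x y ≤ dist x z
  dist-≤-by-pred {x} {y} {z} {w} x⟶*z x≢z x⟶*w w⟶y closer =
    let w′ , x⟶*w′ , w′⟶z , w′<z = dist-pred x⟶*z x≢z in
    begin
      dist x y        ≤⟨ dist-step x⟶*w w⟶y ⟩
      suc (dist x w)  ≤⟨ s≤s (closer x⟶*w′ w′⟶z w′<z) ⟩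
      suc (dist x w′) ≤⟨ w′<z ⟩
      dist x z        ∎
    where open ≤-Reasoning

  pred-of-nearer : ∀ {x y z} → x ⟶* y → dist x y ≤ dist x z → x ≢ y →
    x ≢ z × ∃ λ w → x ⟶* w × w ⟶ y × dist x w < dist x y ×
                    (∀ {w′} → x ⟶* w′ → w′ ⟶ z → dist x w ≤ dist x w′)
  pred-of-nearer {x} {y} {z} x⟶*y y≤z x≢y =
    let w , x⟶*w , w⟶y , w<y = dist-pred x⟶*y x≢y in
    x≢z w<y , w , x⟶*w , w⟶y , w<y ,
    λ x⟶*w′ w′⟶z → s≤s⁻¹ (≤-trans w<y (≤-trans y≤z (dist-step x⟶*w′ w′⟶z)))
    where
    x≢z : ∀ {w} → dist x w < dist x y → x ≢ z
    x≢z w<y refl = n≮0 (≤-trans w<y (subst (dist x y ≤_) (dist-self x) y≤z))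

  reach-noFarther-isSolution : IsSolution _⟶*_ NoFarther
  reach-noFarther-isSolution = record
    { S-refl   = λ _ → inj₁ refl
    ; S-step   = λ x⟶*w w⟶y → inj₂ (⟶*-snoc x⟶*w w⟶y)
    ; L-unfold = unfold
    ; L-fold   = fold
    ; L-trans  = λ (x⟶*y , _ , y≤z) (_ , x⟶*u , z≤u) → x⟶*y , x⟶*u , ≤-trans y≤z z≤u
    ; S-pred   = pred
    ; L-refl   = λ x⟶*y → x⟶*y , x⟶*y , ≤-refl
    }
    where
    unfold : ∀ {x y z} → NoFarther x y z → NoFartherStep _⟶*_ NoFarther x y z
    unfold {x} {y} (x⟶*y , x⟶*z , y≤z) with x ≟ y
    ... | yes x≡y = x⟶*y , x⟶*z , inj₁ x≡y
    ... | no  x≢y =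
      let x≢z , w , x⟶*w , w⟶y , _ , closer = pred-of-nearer x⟶*y y≤z x≢y in
      x⟶*y , x⟶*z ,
      inj₂ (x≢z , w , x⟶*w , w⟶y , λ x⟶*w′ w′⟶z → x⟶*w , x⟶*w′ , closer x⟶*w′ w′⟶z)

    fold : ∀ {x y z} → NoFartherStep _⟶*_ NoFarther x y z → NoFarther x y z
    fold {x} {z = z} (x⟶*y , x⟶*z , inj₁ refl) =
      x⟶*y , x⟶*z , subst (_≤ dist x z) (sym (dist-self x)) z≤n
    fold (x⟶*y , x⟶*z , inj₂ (x≢z , w , x⟶*w , w⟶y , closer)) =
      x⟶*y , x⟶*z ,
      dist-≤-by-pred x⟶*z x≢z x⟶*w w⟶y (λ x⟶*w′ w′⟶z _ → proj₂ (proj₂ (closer x⟶*w′ w′⟶z)))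

    pred : ∀ {x y} → x ⟶* y → x ≢ y →
           ∃ λ w → x ⟶* w × w ⟶ y × NoFarther x w y × ¬ NoFarther x y w
    pred x⟶*y x≢y =
      let w , x⟶*w , w⟶y , w<y = dist-pred x⟶*y x≢y in
      w , x⟶*w , w⟶y , (x⟶*w , x⟶*y , <⇒≤ w<y) , λ (_ , _ , y≤w) → <⇒≱ w<y y≤w

  module _ {S L} (isSol : IsSolution S L) (L? : ∀ x y z → Dec (L x y z)) where
    open IsSolution isSol

    rank : Carrier → Carrier → ℕ
    rank x y = length (filterB (λ u → isYes (L? x u y)) elems)

    rank-pred : ∀ {x w y} → S x y → L x w y → ¬ L x y w → rank x w < rank x y
    rank-pred {x} {w} {y} Sxy Lwy ¬Lyw =
      length-filterB-< (λ Luw → fromWitness (L-trans (toWitness Luw) Lwy))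
        elems (complete y) (fromWitness (L-refl Sxy)) (¬Lyw ∘ toWitness)

    S⇒⟶* : ∀ {x y} → S x y → x ⟶* y
    S⇒⟶* {x} {y} = go (<-wellFounded (rank x y))
      where
      go : ∀ {y} → Acc _<_ (rank x y) → S x y → x ⟶* y
      go {y} (acc rec) Sxy with x ≟ y
      ... | yes x≡y = inj₁ x≡y
      ... | no  x≢y =
        let w , Sxw , w⟶y , Lwy , ¬Lyw = S-pred Sxy x≢y in
        inj₂ (⟶*-snoc (go (rec (rank-pred Sxy Lwy ¬Lyw)) Sxw) w⟶y)

    ⟶*⇒S : ∀ {x y} → x ⟶* y → S x y
    ⟶*⇒S (inj₁ refl)  = S-refl _
    ⟶*⇒S (inj₂ x⟶⁺y) = extend x⟶⁺y (S-refl _)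
      where
      extend : ∀ {x w y} → TC r w y → S x w → S x y
      extend (step w⟶y)        = λ Sxw → S-step Sxw w⟶y
      extend (trans w⟶⁺v v⟶⁺y) = extend v⟶⁺y ∘ extend w⟶⁺v

    L⇒NoFarther : ∀ {x y z} → L x y z → NoFarther x y z
    L⇒NoFarther {x} {y} {z} = go (<-wellFounded (dist x z))
      where
      go : ∀ {y z} → Acc _<_ (dist x z) → L x y z → NoFarther x y z
      go {y} {z} (acc rec) Lyz with L-unfold Lyz
      ... | Sxy , Sxz , inj₁ refl =
        S⇒⟶* Sxy , S⇒⟶* Sxz , subst (_≤ dist x z) (sym (dist-self x)) z≤n
      ... | Sxy , Sxz , inj₂ (x≢z , w , Sxw , w⟶y , closer) =
        S⇒⟶* Sxy , S⇒⟶* Sxz ,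
        dist-≤-by-pred (S⇒⟶* Sxz) x≢z (S⇒⟶* Sxw) w⟶y λ {w′} x⟶*w′ w′⟶z w′<z →
          proj₂ (proj₂ (go {z = w′} (rec w′<z) (closer (⟶*⇒S x⟶*w′) w′⟶z)))

    NoFarther⇒L : ∀ {x y z} → NoFarther x y z → L x y z
    NoFarther⇒L {x} {y} {z} = go (<-wellFounded (dist x y))
      where
      go : ∀ {y z} → Acc _<_ (dist x y) → NoFarther x y z → L x y z
      go {y} (acc rec) (x⟶*y , x⟶*z , y≤z) with x ≟ y
      ... | yes x≡y = L-fold (⟶*⇒S x⟶*y , ⟶*⇒S x⟶*z , inj₁ x≡y)
      ... | no  x≢y =
        let x≢z , w , x⟶*w , w⟶y , w<y , closer = pred-of-nearer x⟶*y y≤z x≢y in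
        L-fold (⟶*⇒S x⟶*y , ⟶*⇒S x⟶*z , inj₂ (x≢z , w , ⟶*⇒S x⟶*w , w⟶y , λ Sxw′ w′⟶z →
          go {w} (rec w<y) (x⟶*w , S⇒⟶* Sxw′ , closer (S⇒⟶* Sxw′) w′⟶z)))

  isSolution-resp : ∀ {S S′ L L′} →
                    (∀ {x y} → S x y ⇔ S′ x y) → (∀ {x y z} → L x y z ⇔ L′ x y z) →
                    IsSolution S L → IsSolution S′ L′
  isSolution-resp {S} {S′} {L} {L′} S⇔S′ L⇔L′ isSol = record
    { S-refl   = λ x → S⁺ (S-refl x)
    ; S-step   = λ S′xw w⟶y → S⁺ (S-step (S⁻ S′xw) w⟶y)
    ; L-unfold = λ L′xyz → step-resp {S} {S′} {L} {L′} S⁺ S⁻ L⁺ (L-unfold (L⁻ L′xyz))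
    ; L-fold   = λ step′ → L⁺ (L-fold (step-resp {S′} {S} {L′} {L} S⁻ S⁺ L⁻ step′))
    ; L-trans  = λ L′xyz L′xzu → L⁺ (L-trans (L⁻ L′xyz) (L⁻ L′xzu))
    ; S-pred   = λ S′xy x≢y → let w , Sxw , w⟶y , Lwy , ¬Lyw = S-pred (S⁻ S′xy) x≢y in
                              w , S⁺ Sxw , w⟶y , L⁺ Lwy , ¬Lyw ∘ L⁻
    ; L-refl   = L⁺ ∘ L-refl ∘ S⁻
    }
    where
    open IsSolution isSol
    S⁺ : ∀ {x y} → S x y → S′ x y
    S⁺ = to S⇔S′
    S⁻ : ∀ {x y} → S′ x y → S x y
    S⁻ = from S⇔S′
    L⁺ : ∀ {x y z} → L x y z → L′ x y z
    L⁺ = to L⇔L′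
    L⁻ : ∀ {x y z} → L′ x y z → L x y z
    L⁻ = from L⇔L′
    step-resp : ∀ {S S′ L L′} → (∀ {x y} → S x y → S′ x y) → (∀ {x y} → S′ x y → S x y) →
                (∀ {x y z} → L x y z → L′ x y z) →
                ∀ {x y z} → NoFartherStep S L x y z → NoFartherStep S′ L′ x y z
    step-resp S⇒S′ S′⇒S L⇒L′ (Sxy , Sxz , inj₁ x≡y) = S⇒S′ Sxy , S⇒S′ Sxz , inj₁ x≡y
    step-resp S⇒S′ S′⇒S L⇒L′ (Sxy , Sxz , inj₂ (x≢z , w , Sxw , w⟶y , closer)) =
      S⇒S′ Sxy , S⇒S′ Sxz ,
      inj₂ (x≢z , w , S⇒S′ Sxw , w⟶y , λ S′xw′ w′⟶z → L⇒L′ (closer (S′⇒S S′xw′) w′⟶z))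

module FlatRelations (D : Domain) where
  open Domain D
  open Sem D

  FlatTuple : List Ty → Set
  FlatTuple = All (_≡ base)

  instance
    flat-[] : FlatTuple []
    flat-[] = []

    flat-∷ : ∀ {ts} → {{FlatTuple ts}} → FlatTuple (base ∷ ts)
    flat-∷ {{fl}} = refl ∷ fl

  ≟⇒≡ : ∀ {a b} → T (isYes (a ≟ b)) → a ≡ b
  ≟⇒≡ {a} {b} = toWitness {a? = a ≟ b}

  ≡⇒≟ : ∀ {a b} → a ≡ b → T (isYes (a ≟ b))
  ≡⇒≟ {a} {b} = fromWitness {a? = a ≟ b}

  eqT⇒≡ : ∀ {ts} → FlatTuple ts → ∀ r s → T (eqT ts r s) → r ≡ s
  eqT⇒≡ [] _ _ _ = refl
  eqT⇒≡ (refl ∷ fl) (a , r) (b , s) eq =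
    let a≟b , r≟s = to T-∧ eq in cong₂ _,_ (≟⇒≡ a≟b) (eqT⇒≡ fl r s r≟s)

  eqT-refl : ∀ {ts} → FlatTuple ts → ∀ r → T (eqT ts r r)
  eqT-refl [] _ = _
  eqT-refl (refl ∷ fl) (a , r) = from T-∧ (≡⇒≟ refl , eqT-refl fl r)

  any-eqT⇔∈ : ∀ {ts} {{_ : FlatTuple ts}} {r} xs → T (any (eqT ts r) xs) ⇔ r ∈ xs
  any-eqT⇔∈ {{fl}} {r} xs = mk⇔
    (λ h → let s , s∈xs , r≈s = find (any⁻ _ xs h) in subst (_∈ xs) (sym (eqT⇒≡ fl r s r≈s)) s∈xs)
    (λ r∈xs → any⁺ _ (lose r∈xs (eqT-refl fl r)))

  _∈?_ : ∀ {ts} {{_ : FlatTuple ts}} (r : Tuple ts) xs → Dec (r ∈ xs)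
  r ∈? xs = Dec.map (any-eqT⇔∈ {r = r} xs) (T? _)

  ∈-difference : ∀ {ts} {{_ : FlatTuple ts}} {r} xs ys →
    r ∈ filterB (λ r → not (any (eqT ts r) ys)) xs ⇔ (r ∈ xs × r ∉ ys)
  ∈-difference xs ys = mk⇔
    (λ r∈ → let r∈xs , r∉ = ∈-filterB⁻ _ xs r∈ in
            r∈xs , λ r∈ys → to T-not r∉ (from (any-eqT⇔∈ ys) r∈ys))
    (λ (r∈xs , r∉ys) → ∈-filterB⁺ _ r∈xs
            (from T-not λ h → r∉ys (to (any-eqT⇔∈ ys) h)))

  eqV⇔⊆⊇ : ∀ {ts} {{_ : FlatTuple ts}} (xs ys : Val (tup base ts)) →
    T (eqV (tup base ts) xs ys) ⇔ ((xs ⊆ ys) × (ys ⊆ xs))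
  eqV⇔⊆⊇ xs ys = mk⇔ forth back
    where
    ⊆-of : ∀ xs ys → T (all (λ r → any (eqT (base ∷ _) r) ys) xs) → xs ⊆ ys
    ⊆-of xs ys h r∈xs = to (any-eqT⇔∈ ys) (All.lookup (all⁺ _ xs h) r∈xs)
    of-⊆ : ∀ xs ys → xs ⊆ ys → T (all (λ r → any (eqT (base ∷ _) r) ys) xs)
    of-⊆ xs ys xs⊆ys = all⁻ _ (All.tabulate λ r∈xs → from (any-eqT⇔∈ ys) (xs⊆ys r∈xs))
    forth : T (eqV (tup base _) xs ys) → xs ⊆ ys × ys ⊆ xs
    forth h = let h₁ , h₂ = to T-∧ h in ⊆-of xs ys h₁ , ⊆-of ys xs h₂
    back : xs ⊆ ys × ys ⊆ xs → T (eqV (tup base _) xs ys)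
    back (xs⊆ys , ys⊆xs) = from T-∧ (of-⊆ xs ys xs⊆ys , of-⊆ ys xs ys⊆xs)

  ⇔⇒eqV : ∀ {ts} {{_ : FlatTuple ts}} {xs ys : Val (tup base ts)} →
          (∀ {p} → p ∈ xs ⇔ p ∈ ys) → T (eqV (tup base ts) xs ys)
  ⇔⇒eqV {xs = xs} {ys} xs⇔ys = from (eqV⇔⊆⊇ xs ys) (xs⊆ys , ys⊆xs)
    where
    xs⊆ys : xs ⊆ ys
    xs⊆ys = to xs⇔ys
    ys⊆xs : ys ⊆ xs
    ys⊆xs = from xs⇔ys

  allT-complete : ∀ {ts} → FlatTuple ts → ∀ r → r ∈ allT ts
  allT-complete []          tt      = here refl
  allT-complete (refl ∷ fl) (a , r) = ∈-cart⁺ (complete a) (allT-complete fl r)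

  relation : ∀ {ts} {P : Tuple (base ∷ ts) → Set} → Decidable P → Val (tup base ts)
  relation {ts} P? = filterB (isYes ∘ P?) (allT (base ∷ ts))

  ∈-relation : ∀ {ts} {{_ : FlatTuple ts}} {P : Tuple (base ∷ ts) → Set} (P? : Decidable P) {r} →
               r ∈ relation P? ⇔ P r
  ∈-relation {ts} {{fl}} P? {r} = mk⇔
    (λ r∈ → toWitness (proj₂ (∈-filterB⁻ (isYes ∘ P?) (allT (base ∷ ts)) r∈)))
    (λ Pr → ∈-filterB⁺ (isYes ∘ P?) (allT-complete (refl ∷ fl) r) (fromWitness Pr))

  relation∈allV : ∀ {ts} {P : Tuple (base ∷ ts) → Set} (P? : Decidable P) →
                  relation P? ∈ allV (tup base ts)
  relation∈allV {ts} P? = filterB∈subs (isYes ∘ P?) (allT (base ∷ ts))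

T₁ T₂ T₃ : Ty
T₁ = tup base []
T₂ = tup base (base ∷ [])
T₃ = tup base (base ∷ base ∷ [])

module _ {Γ : List Ty} where

  diagonal : Expr Γ T₂
  diagonal = proj (# 0) (# 0 ∷ []) dom

  triples : Expr Γ T₃
  triples = (dom ⊗ dom) ⊗ dom

  sameAt₀₁ sameAt₀₂ : Expr Γ T₃
  sameAt₀₁ = sel (# 0) (# 1) refl triples
  sameAt₀₂ = sel (# 0) (# 2) refl triples

  compose : Expr Γ T₃ → Expr Γ T₃ → Expr Γ T₃
  compose e f = proj (# 0) (# 1 ∷ # 5 ∷ []) (sel (# 2) (# 4) refl (sel (# 0) (# 3) refl (e ⊗ f)))

  swap : Expr Γ T₃ → Expr Γ T₃
  swap = proj (# 0) (# 2 ∷ # 1 ∷ [])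

  outer : Expr Γ T₃ → Expr Γ T₂
  outer = proj (# 0) (# 2 ∷ [])

  duplicateSecond : Expr Γ T₂ → Expr Γ T₃
  duplicateSecond = proj (# 0) (# 1 ∷ # 1 ∷ [])

  _∩_ : ∀ {t ts} → Expr Γ (tup t ts) → Expr Γ (tup t ts) → Expr Γ (tup t ts)
  e ∩ f = e ∖ (e ∖ f)

  _⊈_ : ∀ {ts} → Expr Γ (tup base ts) → Expr Γ (tup base ts) → Expr Γ T₁
  e ⊈ f = proj (# 0) [] (e ∖ f)

  ∅ : Expr Γ T₁
  ∅ = dom ∖ dom

-- Scope of the equation: the unknowns S and L, then the input relation R (de Bruijn order).
Δ : List Ty
Δ = T₂ ∷ T₃ ∷ T₂ ∷ []

Sᵉ Rᵉ : Expr Δ T₂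
Sᵉ = var here
Rᵉ = var (there (there here))

Lᵉ : Expr Δ T₃
Lᵉ = var (there here)

pathStep : Expr Δ T₃
pathStep = proj (# 0) (# 1 ∷ # 3 ∷ []) (sel (# 1) (# 2) refl (Sᵉ ⊗ Rᵉ))

reachPair : Expr Δ T₃
reachPair = proj (# 0) (# 1 ∷ # 3 ∷ []) (sel (# 0) (# 2) refl (Sᵉ ⊗ Sᵉ))

belowPreds : Expr Δ T₃
belowPreds = triples ∖ compose (triples ∖ Lᵉ) pathStep

noFartherStep : Expr Δ T₃
noFartherStep = (reachPair ∩ sameAt₀₁) ∪ ((reachPair ∖ sameAt₀₂) ∩ compose (swap pathStep) belowPreds)

closerPred : Expr Δ T₃
closerPred = (pathStep ∩ Lᵉ) ∖ swap Lᵉ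

violations : Expr Δ T₁
violations =
  (diagonal ⊈ Sᵉ) ∪ ((outer pathStep ⊈ Sᵉ) ∪ ((Lᵉ ⊈ noFartherStep) ∪ ((noFartherStep ⊈ Lᵉ) ∪
  ((compose Lᵉ Lᵉ ⊈ Lᵉ) ∪ (((Sᵉ ∖ diagonal) ⊈ outer closerPred) ∪ (duplicateSecond Sᵉ ⊈ Lᵉ))))))

solutions : Expr (RType ∷ []) (tup T₂ (T₃ ∷ []))
solutions = sol (base , base ∷ []) ((base , base ∷ base ∷ []) ∷ []) violations ∅

solutionRelations : Expr (RType ∷ []) T₂
solutionRelations = unnestAll base (base ∷ []) (proj (# 0) [] solutions)

transitiveClosure : Expr (RType ∷ []) RType
transitiveClosure = proj (# 0) (# 3 ∷ []) (sel (# 1) (# 2) refl (var here ⊗ solutionRelations))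

module ExpressionSemantics (D : Domain) where
  open Domain D
  open Sem D
  open FlatRelations D

  module InEnvironment {Γ : List Ty} (ρ : Tuple Γ) where

    ∈-dom : ∀ a → (a , tt) ∈ eval {Γ} dom ρ
    ∈-dom a = ∈-map⁺ _ (complete a)

    ∈-⊗⁻ : ∀ {t ts u us} (e : Expr Γ (tup t ts)) (f : Expr Γ (tup u us)) {z} → z ∈ eval (e ⊗ f) ρ →
           ∃₂ λ p q → p ∈ eval e ρ × q ∈ eval f ρ × z ≡ (proj₁ p , appT ts (proj₂ p) q)
    ∈-⊗⁻ {ts = ts} e f z∈ = ∈-cartesianProductWith⁻ _ (eval e ρ) (eval f ρ)
      (subst (_ ∈_) (concatMap-map≡cartesianProductWith _ (eval e ρ) (eval f ρ)) z∈)

    ∈-⊗⁺ : ∀ {t ts u us} (e : Expr Γ (tup t ts)) (f : Expr Γ (tup u us)) {p q} →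
           p ∈ eval e ρ → q ∈ eval f ρ → (proj₁ p , appT ts (proj₂ p) q) ∈ eval (e ⊗ f) ρ
    ∈-⊗⁺ {ts = ts} e f p∈ q∈ =
      subst (_ ∈_) (sym (concatMap-map≡cartesianProductWith _ (eval e ρ) (eval f ρ)))
        (∈-cartesianProductWith⁺ (λ p q → proj₁ p , appT ts (proj₂ p) q) p∈ q∈)

    ∈-∖ : ∀ {ts} {{_ : FlatTuple ts}} (e f : Expr Γ (tup base ts)) {z} →
          z ∈ eval (e ∖ f) ρ ⇔ (z ∈ eval e ρ × z ∉ eval f ρ)
    ∈-∖ e f = ∈-difference (eval e ρ) (eval f ρ)

    ∈-∩ : ∀ {ts} {{_ : FlatTuple ts}} (e f : Expr Γ (tup base ts)) {z} →
          z ∈ eval (e ∩ f) ρ ⇔ (z ∈ eval e ρ × z ∈ eval f ρ)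
    ∈-∩ e f {z} = mk⇔
      (λ z∈ → let z∈e , z∉e∖f = to (∈-∖ e (e ∖ f)) z∈ in
              z∈e , decidable-stable (z ∈? eval f ρ) λ z∉f → z∉e∖f (from (∈-∖ e f) (z∈e , z∉f)))
      (λ (z∈e , z∈f) → from (∈-∖ e (e ∖ f))
              (z∈e , λ z∈e∖f → proj₂ (to (∈-∖ e f) z∈e∖f) z∈f))

    ∈-triples : ∀ x y z → (x , y , z , tt) ∈ eval {Γ} triples ρ
    ∈-triples x y z = ∈-⊗⁺ (dom ⊗ dom) dom (∈-⊗⁺ dom dom (∈-dom x) (∈-dom y)) (∈-dom z)

    ∈-diagonal : ∀ {x y} → (x , y , tt) ∈ eval {Γ} diagonal ρ ⇔ x ≡ y
    ∈-diagonal {x} = mk⇔ forth back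
      where
      forth : ∀ {y} → (x , y , tt) ∈ eval {Γ} diagonal ρ → x ≡ y
      forth h with ∈-map⁻ _ h
      ... | _ , _ , refl = refl
      back : ∀ {y} → x ≡ y → (x , y , tt) ∈ eval {Γ} diagonal ρ
      back refl = ∈-map⁺ _ (∈-dom x)

    ∈-sameAt₀₁ : ∀ {x y z} → (x , y , z , tt) ∈ eval {Γ} sameAt₀₁ ρ ⇔ x ≡ y
    ∈-sameAt₀₁ {x} {y} {z} = mk⇔
      (λ h → ≟⇒≡ (proj₂ (∈-filterB⁻ _ (eval triples ρ) h)))
      (λ x≡y → ∈-filterB⁺ _ (∈-triples x y z) (≡⇒≟ x≡y))

    ∈-sameAt₀₂ : ∀ {x y z} → (x , y , z , tt) ∈ eval {Γ} sameAt₀₂ ρ ⇔ x ≡ z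
    ∈-sameAt₀₂ {x} {y} {z} = mk⇔
      (λ h → ≟⇒≡ (proj₂ (∈-filterB⁻ _ (eval triples ρ) h)))
      (λ x≡z → ∈-filterB⁺ _ (∈-triples x y z) (≡⇒≟ x≡z))

    ∈-compose : ∀ (e f : Expr Γ T₃) {x a c} → (x , a , c , tt) ∈ eval (compose e f) ρ ⇔
                ∃ λ b → (x , a , b , tt) ∈ eval e ρ × (x , b , c , tt) ∈ eval f ρ
    ∈-compose e f = mk⇔ forth back
      where
      forth : ∀ {x a c} → (x , a , c , tt) ∈ eval (compose e f) ρ →
              ∃ λ b → (x , a , b , tt) ∈ eval e ρ × (x , b , c , tt) ∈ eval f ρ
      forth h with ∈-map⁻ _ h
      ... | _ , p∈ , refl with ∈-filterB⁻ _ _ p∈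
      ... | p∈′ , b≟b′ with ∈-filterB⁻ _ (eval (e ⊗ f) ρ) p∈′
      ... | p∈″ , x≟x′ with ∈-⊗⁻ e f p∈″
      ... | (x , a , b , tt) , (x′ , b′ , c , tt) , q∈e , s∈f , refl with ≟⇒≡ x≟x′ | ≟⇒≡ b≟b′
      ... | refl | refl = b , q∈e , s∈f
      back : ∀ {x a c} → (∃ λ b → (x , a , b , tt) ∈ eval e ρ × (x , b , c , tt) ∈ eval f ρ) →
             (x , a , c , tt) ∈ eval (compose e f) ρ
      back (b , q∈e , s∈f) =
        ∈-map⁺ _ (∈-filterB⁺ _ (∈-filterB⁺ _ (∈-⊗⁺ e f q∈e s∈f) (≡⇒≟ refl)) (≡⇒≟ refl))

    ∈-outer : ∀ (e : Expr Γ T₃) {x y} →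
              (x , y , tt) ∈ eval (outer e) ρ ⇔ ∃ λ w → (x , w , y , tt) ∈ eval e ρ
    ∈-outer e = mk⇔ forth (λ (_ , h) → ∈-map⁺ _ h)
      where
      forth : ∀ {x y} → (x , y , tt) ∈ eval (outer e) ρ → ∃ λ w → (x , w , y , tt) ∈ eval e ρ
      forth h with ∈-map⁻ _ h
      ... | _ , p∈ , refl = _ , p∈

    ∈-duplicateSecond : ∀ (e : Expr Γ T₂) {x y z} →
                        (x , y , z , tt) ∈ eval (duplicateSecond e) ρ ⇔ ((x , y , tt) ∈ eval e ρ × y ≡ z)
    ∈-duplicateSecond e = mk⇔ forth back
      where
      forth : ∀ {x y z} → (x , y , z , tt) ∈ eval (duplicateSecond e) ρ → (x , y , tt) ∈ eval e ρ × y ≡ z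
      forth h with ∈-map⁻ _ h
      ... | _ , p∈ , refl = p∈ , refl
      back : ∀ {x y z} → (x , y , tt) ∈ eval e ρ × y ≡ z → (x , y , z , tt) ∈ eval (duplicateSecond e) ρ
      back (h , refl) = ∈-map⁺ _ h

    ∈-swap : ∀ (e : Expr Γ T₃) {x a b} → (x , a , b , tt) ∈ eval (swap e) ρ ⇔ (x , b , a , tt) ∈ eval e ρ
    ∈-swap e = mk⇔ forth (∈-map⁺ _)
      where
      forth : ∀ {x a b} → (x , a , b , tt) ∈ eval (swap e) ρ → (x , b , a , tt) ∈ eval e ρ
      forth h with ∈-map⁻ _ h
      ... | _ , p∈ , refl = p∈

    ⊈⊆[]⇔⊆ : ∀ {ts} {{_ : FlatTuple ts}} (e f : Expr Γ (tup base ts)) →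
             eval (e ⊈ f) ρ ⊆ [] ⇔ eval e ρ ⊆ eval f ρ
    ⊈⊆[]⇔⊆ e f = mk⇔ forth back
      where
      forth : eval (e ⊈ f) ρ ⊆ [] → eval e ρ ⊆ eval f ρ
      forth h {z} z∈e with z ∈? eval f ρ
      ... | yes z∈f = z∈f
      ... | no  z∉f = ⊥-elim (¬Any[] (h (∈-map⁺ _ (from (∈-∖ e f) (z∈e , z∉f)))))
      back : eval e ρ ⊆ eval f ρ → eval (e ⊈ f) ρ ⊆ []
      back e⊆f w∈ with ∈-map⁻ _ w∈
      ... | _ , z∈e∖f , _ = let z∈e , z∉f = to (∈-∖ e f) z∈e∖f in ⊥-elim (z∉f (e⊆f z∈e))

    ∅⊆[] : eval {Γ} ∅ ρ ⊆ []
    ∅⊆[] z∈ = let z∈dom , z∉dom = to (∈-∖ dom dom) z∈ in ⊥-elim (z∉dom z∈dom)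

    ≈∅⇔⊆[] : ∀ (xs : Val T₁) → T (eqV T₁ xs (eval {Γ} ∅ ρ)) ⇔ xs ⊆ []
    ≈∅⇔⊆[] xs = mk⇔ forth back
      where
      forth : T (eqV T₁ xs (eval ∅ ρ)) → xs ⊆ []
      forth h z∈ = ∅⊆[] (proj₁ (to (eqV⇔⊆⊇ xs (eval ∅ ρ)) h) z∈)
      back : xs ⊆ [] → T (eqV T₁ xs (eval ∅ ρ))
      back xs⊆[] = from (eqV⇔⊆⊇ xs (eval ∅ ρ))
                     ((λ z∈ → ⊥-elim (¬Any[] (xs⊆[] z∈))) , λ z∈ → ⊥-elim (¬Any[] (∅⊆[] z∈)))

  module Candidate (S : Val T₂) (L : Val T₃) (r : Val T₂) where
    open Reachability D r using (_⟶_)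
    open DistanceOrder D r using (IsSolution; NoFartherStep)

    ρ : Tuple Δ
    ρ = S , L , r , tt

    open InEnvironment {Δ} ρ

    S∋ : Carrier → Carrier → Set
    S∋ x y = (x , y , tt) ∈ S

    L∋ : Carrier → Carrier → Carrier → Set
    L∋ x y z = (x , y , z , tt) ∈ L

    ∈-pathStep : ∀ {x w y} → (x , w , y , tt) ∈ eval pathStep ρ ⇔ (S∋ x w × w ⟶ y)
    ∈-pathStep = mk⇔ forth back
      where
      forth : ∀ {x w y} → (x , w , y , tt) ∈ eval pathStep ρ → S∋ x w × w ⟶ y
      forth h with ∈-map⁻ _ h
      ... | _ , p∈ , refl with ∈-filterB⁻ _ (eval (Sᵉ ⊗ Rᵉ) ρ) p∈
      ... | p∈′ , w≟w′ with ∈-⊗⁻ Sᵉ Rᵉ p∈′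
      ... | (x , w , tt) , (w′ , y , tt) , Sxw , w′⟶y , refl with ≟⇒≡ w≟w′
      ... | refl = Sxw , w′⟶y
      back : ∀ {x w y} → S∋ x w × w ⟶ y → (x , w , y , tt) ∈ eval pathStep ρ
      back (Sxw , w⟶y) = ∈-map⁺ _ (∈-filterB⁺ _ (∈-⊗⁺ Sᵉ Rᵉ Sxw w⟶y) (≡⇒≟ refl))

    ∈-reachPair : ∀ {x y z} → (x , y , z , tt) ∈ eval reachPair ρ ⇔ (S∋ x y × S∋ x z)
    ∈-reachPair = mk⇔ forth back
      where
      forth : ∀ {x y z} → (x , y , z , tt) ∈ eval reachPair ρ → S∋ x y × S∋ x z
      forth h with ∈-map⁻ _ h
      ... | _ , p∈ , refl with ∈-filterB⁻ _ (eval (Sᵉ ⊗ Sᵉ) ρ) p∈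
      ... | p∈′ , x≟x′ with ∈-⊗⁻ Sᵉ Sᵉ p∈′
      ... | (x , y , tt) , (x′ , z , tt) , Sxy , Sx′z , refl with ≟⇒≡ x≟x′
      ... | refl = Sxy , Sx′z
      back : ∀ {x y z} → S∋ x y × S∋ x z → (x , y , z , tt) ∈ eval reachPair ρ
      back (Sxy , Sxz) = ∈-map⁺ _ (∈-filterB⁺ _ (∈-⊗⁺ Sᵉ Sᵉ Sxy Sxz) (≡⇒≟ refl))

    ∈-belowPreds : ∀ {x w z} → (x , w , z , tt) ∈ eval belowPreds ρ ⇔
                   (∀ {w′} → S∋ x w′ → w′ ⟶ z → L∋ x w w′)
    ∈-belowPreds {x} {w} {z} = mk⇔ forth back
      where
      abovePred : Expr Δ T₃
      abovePred = compose (triples ∖ Lᵉ) pathStep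
      forth : (x , w , z , tt) ∈ eval belowPreds ρ → ∀ {w′} → S∋ x w′ → w′ ⟶ z → L∋ x w w′
      forth h {w′} Sxw′ w′⟶z with (x , w , w′ , tt) ∈? L
      ... | yes Lxww′ = Lxww′
      ... | no ¬Lxww′ =
        ⊥-elim (proj₂ (to (∈-∖ triples abovePred) h) (from (∈-compose (triples ∖ Lᵉ) pathStep)
          (w′ , from (∈-∖ triples Lᵉ) (∈-triples x w w′ , ¬Lxww′) , from ∈-pathStep (Sxw′ , w′⟶z))))
      back : (∀ {w′} → S∋ x w′ → w′ ⟶ z → L∋ x w w′) → (x , w , z , tt) ∈ eval belowPreds ρ
      back below = from (∈-∖ triples abovePred) (∈-triples x w z , λ h →
        let w′ , h₁ , h₂ = to (∈-compose (triples ∖ Lᵉ) pathStep) h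
            Sxw′ , w′⟶z = to ∈-pathStep h₂
        in proj₂ (to (∈-∖ triples Lᵉ) h₁) (below Sxw′ w′⟶z))

    ∈-noFartherStep : ∀ {x y z} → (x , y , z , tt) ∈ eval noFartherStep ρ ⇔ NoFartherStep S∋ L∋ x y z
    ∈-noFartherStep = mk⇔ forth back
      where
      atSource viaPred : Expr Δ T₃
      atSource = reachPair ∩ sameAt₀₁
      viaPred  = compose (swap pathStep) belowPreds
      forth : ∀ {x y z} → (x , y , z , tt) ∈ eval noFartherStep ρ → NoFartherStep S∋ L∋ x y z
      forth h with ∈-++⁻ (eval atSource ρ) h
      ... | inj₁ h₁ =
        let h₂ , x≡y = to (∈-∩ reachPair sameAt₀₁) h₁ in
        let Sxy , Sxz = to ∈-reachPair h₂ in
        Sxy , Sxz , inj₁ (to ∈-sameAt₀₁ x≡y)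
      ... | inj₂ h₁ =
        let h₂ , h₃ = to (∈-∩ (reachPair ∖ sameAt₀₂) viaPred) h₁ in
        let h₄ , x≢z = to (∈-∖ reachPair sameAt₀₂) h₂ in
        let Sxy , Sxz = to ∈-reachPair h₄ in
        let w , h₅ , below = to (∈-compose (swap pathStep) belowPreds) h₃ in
        let Sxw , w⟶y = to ∈-pathStep (to (∈-swap pathStep) h₅) in
        Sxy , Sxz , inj₂ (x≢z ∘ from ∈-sameAt₀₂ , w , Sxw , w⟶y , to ∈-belowPreds below)
      back : ∀ {x y z} → NoFartherStep S∋ L∋ x y z → (x , y , z , tt) ∈ eval noFartherStep ρ
      back (Sxy , Sxz , inj₁ x≡y) =
        ∈-++⁺ˡ (from (∈-∩ reachPair sameAt₀₁) (from ∈-reachPair (Sxy , Sxz) , from ∈-sameAt₀₁ x≡y))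
      back (Sxy , Sxz , inj₂ (x≢z , w , Sxw , w⟶y , below)) =
        ∈-++⁺ʳ (eval atSource ρ) (from (∈-∩ (reachPair ∖ sameAt₀₂) viaPred)
          (from (∈-∖ reachPair sameAt₀₂) (from ∈-reachPair (Sxy , Sxz) , x≢z ∘ to ∈-sameAt₀₂) ,
           from (∈-compose (swap pathStep) belowPreds)
             (w , from (∈-swap pathStep) (from ∈-pathStep (Sxw , w⟶y)) , from ∈-belowPreds below)))

    ∈-closerPred : ∀ {x w y} → (x , w , y , tt) ∈ eval closerPred ρ ⇔
                   (S∋ x w × w ⟶ y × L∋ x w y × ¬ L∋ x y w)
    ∈-closerPred = mk⇔ forth back
      where
      forth : ∀ {x w y} → (x , w , y , tt) ∈ eval closerPred ρ → S∋ x w × w ⟶ y × L∋ x w y × ¬ L∋ x y w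
      forth h =
        let h₁ , ¬Lyw = to (∈-∖ (pathStep ∩ Lᵉ) (swap Lᵉ)) h in
        let h₂ , Lwy = to (∈-∩ pathStep Lᵉ) h₁ in
        let Sxw , w⟶y = to ∈-pathStep h₂ in
        Sxw , w⟶y , Lwy , ¬Lyw ∘ from (∈-swap Lᵉ)
      back : ∀ {x w y} → S∋ x w × w ⟶ y × L∋ x w y × ¬ L∋ x y w → (x , w , y , tt) ∈ eval closerPred ρ
      back (Sxw , w⟶y , Lwy , ¬Lyw) =
        from (∈-∖ (pathStep ∩ Lᵉ) (swap Lᵉ))
          (from (∈-∩ pathStep Lᵉ) (from ∈-pathStep (Sxw , w⟶y) , Lwy) , ¬Lyw ∘ to (∈-swap Lᵉ))

    diagonal⊆S⇔ : eval {Δ} diagonal ρ ⊆ S ⇔ (∀ x → S∋ x x)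
    diagonal⊆S⇔ = mk⇔ forth back
      where
      forth : eval {Δ} diagonal ρ ⊆ S → ∀ x → S∋ x x
      forth h x = h (from ∈-diagonal refl)
      back : (∀ x → S∋ x x) → eval {Δ} diagonal ρ ⊆ S
      back S-refl {x , y , tt} h with to ∈-diagonal h
      ... | refl = S-refl x

    outerPathStep⊆S⇔ : eval (outer pathStep) ρ ⊆ S ⇔ (∀ {x w y} → S∋ x w → w ⟶ y → S∋ x y)
    outerPathStep⊆S⇔ = mk⇔ forth back
      where
      forth : eval (outer pathStep) ρ ⊆ S → ∀ {x w y} → S∋ x w → w ⟶ y → S∋ x y
      forth h Sxw w⟶y = h (from (∈-outer pathStep) (_ , from ∈-pathStep (Sxw , w⟶y)))
      back : (∀ {x w y} → S∋ x w → w ⟶ y → S∋ x y) → eval (outer pathStep) ρ ⊆ S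
      back S-step {x , y , tt} h =
        let _ , h′ = to (∈-outer pathStep) h in let Sxw , w⟶y = to ∈-pathStep h′ in S-step Sxw w⟶y

    L⊆noFartherStep⇔ : L ⊆ eval noFartherStep ρ ⇔ (∀ {x y z} → L∋ x y z → NoFartherStep S∋ L∋ x y z)
    L⊆noFartherStep⇔ = mk⇔ forth back
      where
      forth : L ⊆ eval noFartherStep ρ → ∀ {x y z} → L∋ x y z → NoFartherStep S∋ L∋ x y z
      forth h Lxyz = to ∈-noFartherStep (h Lxyz)
      back : (∀ {x y z} → L∋ x y z → NoFartherStep S∋ L∋ x y z) → L ⊆ eval noFartherStep ρ
      back L-unfold {x , y , z , tt} Lxyz = from ∈-noFartherStep (L-unfold Lxyz)

    noFartherStep⊆L⇔ : eval noFartherStep ρ ⊆ L ⇔ (∀ {x y z} → NoFartherStep S∋ L∋ x y z → L∋ x y z)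
    noFartherStep⊆L⇔ = mk⇔ forth back
      where
      forth : eval noFartherStep ρ ⊆ L → ∀ {x y z} → NoFartherStep S∋ L∋ x y z → L∋ x y z
      forth h xyz = h (from ∈-noFartherStep xyz)
      back : (∀ {x y z} → NoFartherStep S∋ L∋ x y z → L∋ x y z) → eval noFartherStep ρ ⊆ L
      back L-fold {x , y , z , tt} h = L-fold (to ∈-noFartherStep h)

    composeLL⊆L⇔ : eval (compose Lᵉ Lᵉ) ρ ⊆ L ⇔ (∀ {x y z u} → L∋ x y z → L∋ x z u → L∋ x y u)
    composeLL⊆L⇔ = mk⇔ forth back
      where
      forth : eval (compose Lᵉ Lᵉ) ρ ⊆ L → ∀ {x y z u} → L∋ x y z → L∋ x z u → L∋ x y u
      forth h Lxyz Lxzu = h (from (∈-compose Lᵉ Lᵉ) (_ , Lxyz , Lxzu))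
      back : (∀ {x y z u} → L∋ x y z → L∋ x z u → L∋ x y u) → eval (compose Lᵉ Lᵉ) ρ ⊆ L
      back L-trans {x , y , u , tt} h = let _ , Lxyz , Lxzu = to (∈-compose Lᵉ Lᵉ) h in L-trans Lxyz Lxzu

    S∖diagonal⊆outerCloserPred⇔ : eval (Sᵉ ∖ diagonal) ρ ⊆ eval (outer closerPred) ρ ⇔
      (∀ {x y} → S∋ x y → x ≢ y → ∃ λ w → S∋ x w × w ⟶ y × L∋ x w y × ¬ L∋ x y w)
    S∖diagonal⊆outerCloserPred⇔ = mk⇔ forth back
      where
      forth : eval (Sᵉ ∖ diagonal) ρ ⊆ eval (outer closerPred) ρ →
              ∀ {x y} → S∋ x y → x ≢ y → ∃ λ w → S∋ x w × w ⟶ y × L∋ x w y × ¬ L∋ x y w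
      forth h Sxy x≢y =
        let w , h′ = to (∈-outer closerPred) (h (from (∈-∖ Sᵉ diagonal) (Sxy , x≢y ∘ to ∈-diagonal)))
        in w , to ∈-closerPred h′
      back : (∀ {x y} → S∋ x y → x ≢ y → ∃ λ w → S∋ x w × w ⟶ y × L∋ x w y × ¬ L∋ x y w) →
             eval (Sᵉ ∖ diagonal) ρ ⊆ eval (outer closerPred) ρ
      back S-pred {x , y , tt} h =
        let Sxy , x≢y = to (∈-∖ Sᵉ diagonal) h in
        let w , closer = S-pred Sxy (x≢y ∘ from ∈-diagonal) in
        from (∈-outer closerPred) (w , from ∈-closerPred closer)

    duplicateSecondS⊆L⇔ : eval (duplicateSecond Sᵉ) ρ ⊆ L ⇔ (∀ {x y} → S∋ x y → L∋ x y y)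
    duplicateSecondS⊆L⇔ = mk⇔ forth back
      where
      forth : eval (duplicateSecond Sᵉ) ρ ⊆ L → ∀ {x y} → S∋ x y → L∋ x y y
      forth h Sxy = h (from (∈-duplicateSecond Sᵉ) (Sxy , refl))
      back : (∀ {x y} → S∋ x y → L∋ x y y) → eval (duplicateSecond Sᵉ) ρ ⊆ L
      back L-refl {x , y , z , tt} h with to (∈-duplicateSecond Sᵉ) h
      ... | Sxy , refl = L-refl Sxy

    violations⊆[]⇔IsSolution : eval violations ρ ⊆ [] ⇔ IsSolution S∋ L∋
    violations⊆[]⇔IsSolution = mk⇔ forth back
      where
      clause : ∀ {ts} {{_ : FlatTuple ts}} {P : Set} (e f : Expr Δ (tup base ts)) →
               eval e ρ ⊆ eval f ρ ⇔ P → eval (e ⊈ f) ρ ⊆ [] ⇔ P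
      clause e f = trans-⇔ (⊈⊆[]⇔⊆ e f)

      v₁ v₂ v₃ v₄ v₅ v₆ v₇ : Val T₁
      v₁ = eval (diagonal ⊈ Sᵉ) ρ
      v₂ = eval (outer pathStep ⊈ Sᵉ) ρ
      v₃ = eval (Lᵉ ⊈ noFartherStep) ρ
      v₄ = eval (noFartherStep ⊈ Lᵉ) ρ
      v₅ = eval (compose Lᵉ Lᵉ ⊈ Lᵉ) ρ
      v₆ = eval ((Sᵉ ∖ diagonal) ⊈ outer closerPred) ρ
      v₇ = eval (duplicateSecond Sᵉ ⊈ Lᵉ) ρ

      forth : eval violations ρ ⊆ [] → IsSolution S∋ L∋
      forth h =
        let e₁ , h = to (++⊆[]⇔ v₁ _) h in
        let e₂ , h = to (++⊆[]⇔ v₂ _) h in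
        let e₃ , h = to (++⊆[]⇔ v₃ _) h in
        let e₄ , h = to (++⊆[]⇔ v₄ _) h in
        let e₅ , h = to (++⊆[]⇔ v₅ _) h in
        let e₆ , e₇ = to (++⊆[]⇔ v₆ v₇) h in
        record
          { S-refl   = to (clause diagonal Sᵉ diagonal⊆S⇔) e₁
          ; S-step   = to (clause (outer pathStep) Sᵉ outerPathStep⊆S⇔) e₂
          ; L-unfold = to (clause Lᵉ noFartherStep L⊆noFartherStep⇔) e₃
          ; L-fold   = to (clause noFartherStep Lᵉ noFartherStep⊆L⇔) e₄
          ; L-trans  = to (clause (compose Lᵉ Lᵉ) Lᵉ composeLL⊆L⇔) e₅
          ; S-pred   = to (clause (Sᵉ ∖ diagonal) (outer closerPred) S∖diagonal⊆outerCloserPred⇔) e₆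
          ; L-refl   = to (clause (duplicateSecond Sᵉ) Lᵉ duplicateSecondS⊆L⇔) e₇
          }

      back : IsSolution S∋ L∋ → eval violations ρ ⊆ []
      back isSol =
        from (++⊆[]⇔ v₁ _) (from (clause diagonal Sᵉ diagonal⊆S⇔) S-refl ,
        from (++⊆[]⇔ v₂ _) (from (clause (outer pathStep) Sᵉ outerPathStep⊆S⇔) S-step ,
        from (++⊆[]⇔ v₃ _) (from (clause Lᵉ noFartherStep L⊆noFartherStep⇔) L-unfold ,
        from (++⊆[]⇔ v₄ _) (from (clause noFartherStep Lᵉ noFartherStep⊆L⇔) L-fold ,
        from (++⊆[]⇔ v₅ _) (from (clause (compose Lᵉ Lᵉ) Lᵉ composeLL⊆L⇔) L-trans ,
        from (++⊆[]⇔ v₆ v₇)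
          ( from (clause (Sᵉ ∖ diagonal) (outer closerPred) S∖diagonal⊆outerCloserPred⇔) S-pred
          , from (clause (duplicateSecond Sᵉ) Lᵉ duplicateSecondS⊆L⇔) L-refl))))))
        where open IsSolution isSol

module Correctness (D : Domain) (r : Sem.Val D RType) where
  open Domain D
  open Sem D
  open FlatRelations D
  open ExpressionSemantics D
  open Reachability D r
  open DistanceOrder D r

  module _ {S : Val T₂} {L : Val T₃} where
    open Candidate S L r

    ∈-solutions⁻ : (S , L , tt) ∈ eval solutions (r , tt) → IsSolution S∋ L∋
    ∈-solutions⁻ h = to violations⊆[]⇔IsSolution
      (to (InEnvironment.≈∅⇔⊆[] {Δ} ρ _) (proj₂ (∈-filterB⁻ _ (allT (T₂ ∷ T₃ ∷ [])) h)))

    ∈-solutions⁺ : S ∈ allV T₂ → L ∈ allV T₃ → IsSolution S∋ L∋ → (S , L , tt) ∈ eval solutions (r , tt)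
    ∈-solutions⁺ S∈ L∈ isSol = ∈-filterB⁺ _ (∈-cart⁺ S∈ (∈-cart⁺ L∈ (here refl)))
      (from (InEnvironment.≈∅⇔⊆[] {Δ} ρ _) (from violations⊆[]⇔IsSolution isSol))

  reachRelation : Val T₂
  reachRelation = relation {P = λ (x , y , _) → x ⟶* y} λ (x , y , _) → x ⟶*? y

  noFartherRelation : Val T₃
  noFartherRelation = relation {P = λ (x , y , z , _) → NoFarther x y z}
    λ (x , y , z , _) → (x ⟶*? y) ×-dec (x ⟶*? z) ×-dec (dist x y ≤? dist x z)

  canonical∈solutions : (reachRelation , noFartherRelation , tt) ∈ eval solutions (r , tt)
  canonical∈solutions = ∈-solutions⁺ (relation∈allV _) (relation∈allV _)
    (isSolution-resp (sym-⇔ (∈-relation _)) (sym-⇔ (∈-relation _)) reach-noFarther-isSolution)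

  module _ {S L} (S,L∈ : (S , L , tt) ∈ eval solutions (r , tt)) where
    open Candidate S L r using (S∋; L∋)

    private
      isSol : IsSolution S∋ L∋
      isSol = ∈-solutions⁻ S,L∈
      L? : ∀ x y z → Dec (L∋ x y z)
      L? x y z = (x , y , z , tt) ∈? L

    solution-S⇔⟶* : ∀ {x y} → S∋ x y ⇔ x ⟶* y
    solution-S⇔⟶* = mk⇔ (S⇒⟶* isSol L?) (⟶*⇒S isSol L?)

    solution-L⇔NoFarther : ∀ {x y z} → L∋ x y z ⇔ NoFarther x y z
    solution-L⇔NoFarther = mk⇔ (L⇒NoFarther isSol L?) (NoFarther⇒L isSol L?)

  solutions-agree : ∀ {A B} → A ∈ eval solutions (r , tt) → B ∈ eval solutions (r , tt) →
                    T (eqT (T₂ ∷ T₃ ∷ []) A B)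
  solutions-agree {S , L , tt} {S′ , L′ , tt} A∈ B∈ = from T-∧
    ( ⇔⇒eqV (trans-⇔ (solution-S⇔⟶* A∈) (sym-⇔ (solution-S⇔⟶* B∈)))
    , from T-∧ (⇔⇒eqV (trans-⇔ (solution-L⇔NoFarther A∈) (sym-⇔ (solution-L⇔NoFarther B∈))) , _))

  at-most-one-solution : card {T₂} {T₃ ∷ []} (eval solutions (r , tt)) ≤ 1
  at-most-one-solution = length-dedup≤1 (eqT (T₂ ∷ T₃ ∷ [])) (eval solutions (r , tt)) solutions-agree

  open InEnvironment {RType ∷ []} (r , tt)

  ∈-solutionRelations : ∀ {x y} → (x , y , tt) ∈ eval solutionRelations (r , tt) ⇔
                        ∃₂ λ S L → (S , L , tt) ∈ eval solutions (r , tt) × (x , y , tt) ∈ S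
  ∈-solutionRelations = mk⇔ forth back
    where
    forth : ∀ {x y} → (x , y , tt) ∈ eval solutionRelations (r , tt) →
            ∃₂ λ S L → (S , L , tt) ∈ eval solutions (r , tt) × (x , y , tt) ∈ S
    forth h with find (∈-concatMap⁻ proj₁ h)
    ... | _ , q∈ , xy∈S with ∈-map⁻ (λ (A : Tuple (T₂ ∷ T₃ ∷ [])) → proj₁ A , tt) q∈
    ...   | (S , L , tt) , A∈ , refl = S , L , A∈ , xy∈S
    back : ∀ {x y} → (∃₂ λ S L → (S , L , tt) ∈ eval solutions (r , tt) × (x , y , tt) ∈ S) →
           (x , y , tt) ∈ eval solutionRelations (r , tt)
    back (S , L , A∈ , xy∈S) = ∈-concatMap⁺ proj₁ (lose (∈-map⁺ {A = Tuple (T₂ ∷ T₃ ∷ [])} _ A∈) xy∈S)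

  ∈-transitiveClosure : ∀ {x y} → (x , y , tt) ∈ eval transitiveClosure (r , tt) ⇔
                        ∃ λ w → x ⟶ w × (w , y , tt) ∈ eval solutionRelations (r , tt)
  ∈-transitiveClosure = mk⇔ forth back
    where
    forth : ∀ {x y} → (x , y , tt) ∈ eval transitiveClosure (r , tt) →
            ∃ λ w → x ⟶ w × (w , y , tt) ∈ eval solutionRelations (r , tt)
    forth h with ∈-map⁻ _ h
    ... | _ , p∈ , refl with ∈-filterB⁻ _ (eval (var here ⊗ solutionRelations) (r , tt)) p∈
    ... | p∈′ , w≟w′ with ∈-⊗⁻ (var here) solutionRelations p∈′
    ... | (x , w , tt) , (w′ , y , tt) , x⟶w , w′y∈ , refl with ≟⇒≡ w≟w′
    ... | refl = w , x⟶w , w′y∈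
    back : ∀ {x y} → (∃ λ w → x ⟶ w × (w , y , tt) ∈ eval solutionRelations (r , tt)) →
           (x , y , tt) ∈ eval transitiveClosure (r , tt)
    back (w , x⟶w , wy∈) = ∈-map⁺ _ (∈-filterB⁺ _ (∈-⊗⁺ (var here) solutionRelations x⟶w wy∈) (≡⇒≟ refl))

  transitiveClosure-correct : ∀ {x y} → (x , y , tt) ∈ eval transitiveClosure (r , tt) ⇔ TC r x y
  transitiveClosure-correct = mk⇔ forth back
    where
    forth : ∀ {x y} → (x , y , tt) ∈ eval transitiveClosure (r , tt) → TC r x y
    forth h =
      let w , x⟶w , h′ = to ∈-transitiveClosure h in
      let _ , _ , A∈ , wy∈S = to ∈-solutionRelations h′ in
      ⟶*-cons x⟶w (to (solution-S⇔⟶* A∈) wy∈S)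
    back : ∀ {x y} → TC r x y → (x , y , tt) ∈ eval transitiveClosure (r , tt)
    back x⟶⁺y =
      let w , x⟶w , w⟶*y = TC-uncons x⟶⁺y in
      from ∈-transitiveClosure
        (w , x⟶w , from ∈-solutionRelations (_ , _ , canonical∈solutions , from (∈-relation _) w⟶*y))

solutionFree : ∀ {Γ τ} → Expr Γ τ → Bool
solutionFree (var x)              = true
solutionFree dom                  = true
solutionFree (e ∪ f)              = solutionFree e ∧ solutionFree f
solutionFree (e ∖ f)              = solutionFree e ∧ solutionFree f
solutionFree (e ⊗ f)              = solutionFree e ∧ solutionFree f
solutionFree (proj i is e)        = solutionFree e
solutionFree (sel i j p e)        = solutionFree e
solutionFree (nest t ts u us e)   = solutionFree e
solutionFree (nestAll u us e)     = solutionFree e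
solutionFree (unnest t ts u us e) = solutionFree e
solutionFree (unnestAll u us e)   = solutionFree e
solutionFree (sol X Xs e₁ e₂)     = false

solutionFree⇒AllSparse : ∀ {Γ τ} (e : Expr Γ τ) → T (solutionFree e) → AllSparse e
solutionFree⇒AllSparse (var x)              _ = lift tt
solutionFree⇒AllSparse dom                  _ = lift tt
solutionFree⇒AllSparse (e ∪ f) h =
  let he , hf = to T-∧ h in solutionFree⇒AllSparse e he , solutionFree⇒AllSparse f hf
solutionFree⇒AllSparse (e ∖ f) h =
  let he , hf = to T-∧ h in solutionFree⇒AllSparse e he , solutionFree⇒AllSparse f hf
solutionFree⇒AllSparse (e ⊗ f) h =
  let he , hf = to T-∧ h in solutionFree⇒AllSparse e he , solutionFree⇒AllSparse f hf
solutionFree⇒AllSparse (proj i is e)        h = solutionFree⇒AllSparse e h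
solutionFree⇒AllSparse (sel i j p e)        h = solutionFree⇒AllSparse e h
solutionFree⇒AllSparse (nest t ts u us e)   h = solutionFree⇒AllSparse e h
solutionFree⇒AllSparse (nestAll u us e)     h = solutionFree⇒AllSparse e h
solutionFree⇒AllSparse (unnest t ts u us e) h = solutionFree⇒AllSparse e h
solutionFree⇒AllSparse (unnestAll u us e)   h = solutionFree⇒AllSparse e h

solutions-sparse : SparseSol solutions ((base , base ∷ []) ∷ (base , base ∷ base ∷ []) ∷ [])
solutions-sparse =
  ((refl , refl ∷ []) ∷ (refl , refl ∷ refl ∷ []) ∷ []) ,
  1 , 0 , λ D (r , _) → Correctness.at-most-one-solution D r

proposition7p2 : Σ (Expr (RType ∷ []) RType) λ e →
    AllSparse e ×
    (∀ (D : Domain) (r : Sem.Val D RType) (a b : Domain.Carrier D) →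
      (((a , b , tt) ∈ Sem.eval D e (r , tt)) → TC r a b) ×
      (TC r a b → ((a , b , tt) ∈ Sem.eval D e (r , tt))))
proposition7p2 =
  transitiveClosure ,
  (lift tt , solutions-sparse , solutionFree⇒AllSparse violations _ , solutionFree⇒AllSparse (∅ {Δ}) _) ,
  λ D r a b → let open Correctness D r in to transitiveClosure-correct , from transitiveClosure-correct
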